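{- Let $G$ be a connected finite simple graph that contains a cycle. If $\alpha_1'(G) = 2$, then $G$ has at most four vertices.
   Context: For a graph $G$, a $1$-nearly edge independent set of $G$ is a set $M \subseteq E(G)$ such that $M$ contains exactly one (unordered) pair of distinct edges that are adjacent in $G$ (i.e. share a common end vertex). The $1$-nearly edge independence number $\alpha_1'(G)$ is the maximum cardinality of a $1$-nearly edge independent set of $G$, taken to be $0$ if $G$ has no such set. -}

module Defs where

open import Level using (0ℓ)
open import Data.Nat using (ℕ; _≤_; _<_; suc)
open import Data.Fin using (Fin; toℕ)
open import Data.Product using (Σ; ∃; _×_; _,_)
open import Data.Sum using (_⊎_)
open import Data.List using (List; []; _∷_; length; lookup; last)
open import Data.List.Relation.Unary.Unique.Propositional using (Unique)
open import Data.List.Relation.Unary.All using (All)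
open import Data.List.Relation.Unary.Linked using (Linked)
open import Data.Maybe using (just)
open import Relation.Binary.PropositionalEquality using (_≡_)
open import Relation.Nullary using (¬_; Dec)

record Graph (n : ℕ) : Set₁ where
  field
    Adj     : Fin n → Fin n → Set
    sym     : ∀ {u v} → Adj u v → Adj v u
    irrefl  : ∀ {u} → ¬ Adj u u
    adj?    : ∀ u v → Dec (Adj u v)

module _ {n : ℕ} (G : Graph n) where
  open Graph G

  data Walk : Fin n → Fin n → Set where
    nil  : ∀ {u} → Walk u u
    cons : ∀ {u w v} → Adj u w → Walk w v → Walk u v

  Connected : Set
  Connected = ∀ u v → Walk u v

  record Cycle : Set where
    field
      v₀       : Fin n
      rest     : List (Fin n)
      long     : 2 ≤ length rest
      distinct : Unique (v₀ ∷ rest)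
      path     : Linked Adj (v₀ ∷ rest)
      closing  : ∀ w → last rest ≡ just w → Adj w v₀

  HasCycle : Set
  HasCycle = Cycle

  -- An edge of G, represented canonically as a pair (u , v) with u < v.
  IsEdge : Fin n × Fin n → Set
  IsEdge (u , v) = (toℕ u < toℕ v) × Adj u v

  ShareEnd : Fin n × Fin n → Fin n × Fin n → Set
  ShareEnd (a , b) (c , d) = (a ≡ c ⊎ a ≡ d) ⊎ (b ≡ c ⊎ b ≡ d)

  record EdgeSet : Set where
    field
      edges    : List (Fin n × Fin n)
      allEdges : All IsEdge edges
      noDup    : Unique edges
  open EdgeSet public

  -- M contains exactly one unordered pair of distinct edges that share an
  -- end vertex: positions i < j with lookup i, lookup j sharing an end, and
  -- every such pair of positions i' < j' equals (i , j).
  OneNearlyIndependent : EdgeSet → Set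
  OneNearlyIndependent M =
    Σ (Fin (length (edges M))) λ i → Σ (Fin (length (edges M))) λ j →
      (toℕ i < toℕ j) ×
      ShareEnd (lookup (edges M) i) (lookup (edges M) j) ×
      (∀ i' j' → toℕ i' < toℕ j' →
         ShareEnd (lookup (edges M) i') (lookup (edges M) j') →
         (i' ≡ i × j' ≡ j))

  -- α₁'(G) = k : k is the maximum cardinality of a 1-nearly edge independent
  -- set, with the convention α₁'(G) = 0 if no such set exists.
  NearlyEdgeIndepNumber : ℕ → Set
  NearlyEdgeIndepNumber k =
    (Σ EdgeSet λ M → OneNearlyIndependent M × length (edges M) ≡ k
       × (∀ M' → OneNearlyIndependent M' → length (edges M') ≤ k))
    ⊎ ((k ≡ 0) × (∀ M → ¬ OneNearlyIndependent M))

{-# OPTIONS --safe #-}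
module Submission where

-- If n ≥ 5, connectivity lets every vertex set of size at most 4 be left along
-- an edge. A cycle therefore yields a path a–b–c–d (a triangle is prolonged by
-- an outside neighbour), and an outside neighbour z of that path is joined to
-- one of the two edges ab, cd; together with the other one this is a path on
-- three vertices plus a vertex-disjoint edge. Those three edges form a
-- 1-nearly edge independent set, so α₁'(G) ≥ 3.

open import Defs
open import Data.Nat using (ℕ; _≤_; _<_; _<?_; s≤s; z≤n)
open import Data.Nat.Properties using (≮⇒≥; ≤∧≢⇒<; <⇒≤; <-irrefl; 1+n≰n)
open import Data.Fin using (Fin; toℕ; zero; suc)
open import Data.Fin.Properties using (toℕ-injective; ¬∀⟶∃¬; pigeonhole; _≟_)
open import Data.Product using (Σ; ∃; ∃₂; _×_; _,_)
open import Data.Sum using (_⊎_; inj₁; inj₂; [_,_]′) renaming (swap to ⊎-swap)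
open import Data.Empty using (⊥-elim)
open import Data.List using (List; []; _∷_; length; lookup)
open import Data.List.Relation.Unary.All using ([]; _∷_)
open import Data.List.Relation.Unary.All.Properties using (¬Any⇒All¬)
open import Data.List.Relation.Unary.AllPairs using ([]; _∷_)
open import Data.List.Relation.Unary.Linked using ([-]; _∷_)
open import Data.List.Relation.Unary.Any using (here; there; index)
open import Data.List.Relation.Unary.Unique.Propositional using (Unique)
open import Data.List.Relation.Unary.Unique.Propositional.Properties using (take⁺)
open import Data.List.Relation.Binary.Permutation.Propositional using (_↭_; refl; prep; swap; trans; ↭⇒↭ₛ)
open import Data.List.Relation.Binary.Permutation.Propositional.Properties using (++-comm)
open import Data.List.Membership.Propositional using (_∈_; _∉_)
open import Data.List.Membership.Setoid.Properties using (index-injective)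
open import Relation.Binary.PropositionalEquality using (_≡_; _≢_; refl; cong; subst; setoid)
open import Relation.Nullary using (¬_; yes; no)
open import Function using (_∘_)

module _ {a} {A : Set a} where
  open import Data.List.Relation.Binary.Permutation.Setoid.Properties (setoid A)
    using (Unique-resp-↭)

  Unique-∷⁺-↭ : ∀ {x : A} {xs ys} → x ∉ xs → Unique xs → xs ↭ ys → Unique (x ∷ ys)
  Unique-∷⁺-↭ x∉xs xs! xs↭ys = Unique-resp-↭ (↭⇒↭ₛ (prep _ xs↭ys)) (¬Any⇒All¬ _ x∉xs ∷ xs!)

module _ {n : ℕ} where
  open import Data.List.Membership.DecPropositional (_≟_ {n}) using (_∈?_)

  length<n⇒∃∉ : (S : List (Fin n)) → length S < n → ∃ (_∉ S)
  length<n⇒∃∉ S |S|<n = ¬∀⟶∃¬ n (_∈ S) (_∈? S) covers-none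
    where
      covers-none : ¬ (∀ x → x ∈ S)
      covers-none x∈S with pigeonhole |S|<n (λ x → index (x∈S x))
      ... | i , j , i<j , same =
        <-irrefl (cong toℕ (index-injective (setoid (Fin n)) (x∈S i) (x∈S j) same)) i<j

  module _ (G : Graph n) where
    open Graph G

    OneNearlyIndependentOfSize : ℕ → Set
    OneNearlyIndependentOfSize k =
      Σ (EdgeSet G) λ M → OneNearlyIndependent G M × length (edges M) ≡ k

    Adj⇒≢ : ∀ {u v} → Adj u v → u ≢ v
    Adj⇒≢ uv refl = irrefl uv

    _∈ₑ_ : Fin n → Fin n × Fin n → Set
    x ∈ₑ (u , v) = x ≡ u ⊎ x ≡ v

    ShareEnd-intro : ∀ {x e f} → x ∈ₑ e → x ∈ₑ f → ShareEnd G e f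
    ShareEnd-intro (inj₁ refl) x∈f = inj₁ x∈f
    ShareEnd-intro (inj₂ refl) x∈f = inj₂ x∈f

    ShareEnd-elim : ∀ {e f} → ShareEnd G e f → ∃ λ x → x ∈ₑ e × x ∈ₑ f
    ShareEnd-elim (inj₁ x∈f) = _ , inj₁ refl , x∈f
    ShareEnd-elim (inj₂ x∈f) = _ , inj₂ refl , x∈f

    ¬ShareEnd⇒≢ : ∀ {e f} → ¬ ShareEnd G e f → e ≢ f
    ¬ShareEnd⇒≢ ¬sh refl = ¬sh (inj₁ (inj₁ refl))

    orient : Fin n → Fin n → Fin n × Fin n
    orient u v with toℕ u <? toℕ v
    ... | yes _ = u , v
    ... | no  _ = v , u

    orient-isEdge : ∀ {u v} → Adj u v → IsEdge G (orient u v)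
    orient-isEdge {u} {v} uv with toℕ u <? toℕ v
    ... | yes u<v = u<v , uv
    ... | no  u≮v = ≤∧≢⇒< (≮⇒≥ u≮v) (Adj⇒≢ (sym uv) ∘ toℕ-injective) , sym uv

    ∈ₑ-orient⁺ : ∀ u v {x} → x ∈ₑ (u , v) → x ∈ₑ orient u v
    ∈ₑ-orient⁺ u v x∈ with toℕ u <? toℕ v
    ... | yes _ = x∈
    ... | no  _ = ⊎-swap x∈

    ∈ₑ-orient⁻ : ∀ u v {x} → x ∈ₑ orient u v → x ∈ₑ (u , v)
    ∈ₑ-orient⁻ u v x∈ with toℕ u <? toℕ v
    ... | yes _ = x∈
    ... | no  _ = ⊎-swap x∈

    cherry+edge-oneNearlyIndependent :
      ∀ {e₁ e₂ e₃} → IsEdge G e₁ → IsEdge G e₂ → IsEdge G e₃ → e₁ ≢ e₂ →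
      ShareEnd G e₁ e₂ → ¬ ShareEnd G e₁ e₃ → ¬ ShareEnd G e₂ e₃ →
      OneNearlyIndependentOfSize 3
    cherry+edge-oneNearlyIndependent {e₁} {e₂} {e₃} e₁! e₂! e₃! e₁≢e₂ sh₁₂ ¬sh₁₃ ¬sh₂₃ =
      M , (zero , suc zero , s≤s z≤n , sh₁₂ , only-pair) , refl
      where
        M : EdgeSet G
        M = record
          { edges    = e₁ ∷ e₂ ∷ e₃ ∷ []
          ; allEdges = e₁! ∷ e₂! ∷ e₃! ∷ []
          ; noDup    = (e₁≢e₂ ∷ ¬ShareEnd⇒≢ ¬sh₁₃ ∷ []) ∷ (¬ShareEnd⇒≢ ¬sh₂₃ ∷ []) ∷ [] ∷ []
          }
        only-pair : ∀ i j → toℕ i < toℕ j → ShareEnd G (lookup (edges M) i) (lookup (edges M) j) →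
                    i ≡ zero × j ≡ suc zero
        only-pair zero             (suc zero)       _ _  = refl , refl
        only-pair zero             (suc (suc zero)) _ sh = ⊥-elim (¬sh₁₃ sh)
        only-pair (suc zero)       (suc (suc zero)) _ sh = ⊥-elim (¬sh₂₃ sh)
        only-pair _                zero             () _
        only-pair (suc zero)       (suc zero)       (s≤s ()) _
        only-pair (suc (suc zero)) (suc zero)       (s≤s ()) _
        only-pair (suc (suc zero)) (suc (suc zero)) (s≤s (s≤s ())) _

    orient-shareEnd : ∀ p q r → ShareEnd G (orient p q) (orient q r)
    orient-shareEnd p q r = ShareEnd-intro (∈ₑ-orient⁺ p q (inj₂ refl)) (∈ₑ-orient⁺ q r (inj₁ refl))

    orient-¬shareEnd : ∀ {u v s t} → u ≢ s → u ≢ t → v ≢ s → v ≢ t →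
                       ¬ ShareEnd G (orient u v) (orient s t)
    orient-¬shareEnd {u} {v} {s} {t} u≢s u≢t v≢s v≢t sh with ShareEnd-elim sh
    ... | x , x∈uv , x∈st = disjoint (∈ₑ-orient⁻ u v x∈uv) (∈ₑ-orient⁻ s t x∈st)
      where
        disjoint : ∀ {x} → x ∈ₑ (u , v) → ¬ x ∈ₑ (s , t)
        disjoint (inj₁ refl) = [ u≢s , u≢t ]′
        disjoint (inj₂ refl) = [ v≢s , v≢t ]′

    path₃+edge-oneNearlyIndependent :
      ∀ {p q r s t} → Unique (p ∷ q ∷ r ∷ s ∷ t ∷ []) → Adj p q → Adj q r → Adj s t →
      OneNearlyIndependentOfSize 3
    path₃+edge-oneNearlyIndependent {p} {q} {r}
      ((_ ∷ p≢r ∷ p≢s ∷ p≢t ∷ []) ∷ (_ ∷ q≢s ∷ q≢t ∷ []) ∷ (r≢s ∷ r≢t ∷ []) ∷ _) pq qr st =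
      cherry+edge-oneNearlyIndependent (orient-isEdge pq) (orient-isEdge qr) (orient-isEdge st)
        pq≢qr (orient-shareEnd p q r)
        (orient-¬shareEnd p≢s p≢t q≢s q≢t) (orient-¬shareEnd q≢s q≢t r≢s r≢t)
      where
        pq≢qr : orient p q ≢ orient q r
        pq≢qr eq =
          [ Adj⇒≢ pq , p≢r ]′ (∈ₑ-orient⁻ q r (subst (p ∈ₑ_) eq (∈ₑ-orient⁺ p q (inj₁ refl))))

    Walk⇒crossingEdge : ∀ {S u v} → Walk G u v → u ∈ S → v ∉ S →
                        ∃₂ λ x y → x ∈ S × y ∉ S × Adj x y
    Walk⇒crossingEdge nil                    u∈S v∉S = ⊥-elim (v∉S u∈S)
    Walk⇒crossingEdge {S} (cons {w = w} uw wv) u∈S v∉S with w ∈? S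
    ... | yes w∈S = Walk⇒crossingEdge wv w∈S v∉S
    ... | no  w∉S = _ , _ , u∈S , w∉S , uw

    crossingEdge : Connected G → ∀ {S u} → length S < n → u ∈ S →
                   ∃₂ λ x y → x ∈ S × y ∉ S × Adj x y
    crossingEdge conn {S} {u} |S|<n u∈S with length<n⇒∃∉ S |S|<n
    ... | v , v∉S = Walk⇒crossingEdge (conn u v) u∈S v∉S

    path₄-oneNearlyIndependent :
      Connected G → 5 ≤ n → ∀ {a b c d} → Unique (a ∷ b ∷ c ∷ d ∷ []) →
      Adj a b → Adj b c → Adj c d → OneNearlyIndependentOfSize 3
    path₄-oneNearlyIndependent conn 5≤n {a} {b} {c} {d} abcd! ab _ cd
      with crossingEdge conn 5≤n (here refl)
    ... | _ , _ , here refl , z∉ , az =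
      path₃+edge-oneNearlyIndependent (Unique-∷⁺-↭ z∉ abcd! refl) (sym az) ab cd
    ... | _ , _ , there (here refl) , z∉ , bz =
      path₃+edge-oneNearlyIndependent (Unique-∷⁺-↭ z∉ abcd! (swap a b refl)) (sym bz) (sym ab) cd
    ... | _ , _ , there (there (here refl)) , z∉ , cz =
      path₃+edge-oneNearlyIndependent (Unique-∷⁺-↭ z∉ abcd! ab↔cd) (sym cz) cd ab
      where ab↔cd = ++-comm (a ∷ b ∷ []) (c ∷ d ∷ [])
    ... | _ , _ , there (there (there (here refl))) , z∉ , dz =
      path₃+edge-oneNearlyIndependent (Unique-∷⁺-↭ z∉ abcd! ab↔dc) (sym dz) (sym cd) ab
      where ab↔dc = trans (++-comm (a ∷ b ∷ []) (c ∷ d ∷ [])) (swap c d refl)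

    triangle-oneNearlyIndependent :
      Connected G → 5 ≤ n → ∀ {a b c} → Unique (a ∷ b ∷ c ∷ []) →
      Adj a b → Adj b c → Adj c a → OneNearlyIndependentOfSize 3
    triangle-oneNearlyIndependent conn 5≤n {a} {b} {c} abc! ab bc ca
      with crossingEdge conn (<⇒≤ 5≤n) (here refl)
    ... | _ , _ , here refl , z∉ , az =
      path₄-oneNearlyIndependent conn 5≤n (Unique-∷⁺-↭ z∉ abc! refl) (sym az) ab bc
    ... | _ , _ , there (here refl) , z∉ , bz =
      path₄-oneNearlyIndependent conn 5≤n (Unique-∷⁺-↭ z∉ abc! (++-comm (a ∷ []) (b ∷ c ∷ [])))
        (sym bz) bc ca
    ... | _ , _ , there (there (here refl)) , z∉ , cz =
      path₄-oneNearlyIndependent conn 5≤n (Unique-∷⁺-↭ z∉ abc! (++-comm (a ∷ b ∷ []) (c ∷ [])))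
        (sym cz) ca ab

    cycle-oneNearlyIndependent : Connected G → 5 ≤ n → Cycle G → OneNearlyIndependentOfSize 3
    cycle-oneNearlyIndependent conn 5≤n
      record { rest = _ ∷ _ ∷ [] ; distinct = abc! ; path = ab ∷ bc ∷ [-] ; closing = ca } =
      triangle-oneNearlyIndependent conn 5≤n abc! ab bc (ca _ refl)
    cycle-oneNearlyIndependent conn 5≤n
      record { rest = _ ∷ _ ∷ _ ∷ _ ; distinct = distinct ; path = ab ∷ bc ∷ cd ∷ _ } =
      path₄-oneNearlyIndependent conn 5≤n (take⁺ 4 distinct) ab bc cd
    cycle-oneNearlyIndependent _ _ record { rest = [] ; long = () }
    cycle-oneNearlyIndependent _ _ record { rest = _ ∷ [] ; long = s≤s () }

lemma3p1 : (n : ℕ) (G : Graph n) → Connected G → HasCycle G →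
           NearlyEdgeIndepNumber G 2 → n ≤ 4
lemma3p1 n G conn cycle (inj₂ (() , _))
lemma3p1 n G conn cycle (inj₁ (_ , _ , _ , maximal)) = ≮⇒≥ λ 4<n →
  let M , M-nearlyIndependent , |M|≡3 = cycle-oneNearlyIndependent G conn 4<n cycle
  in 1+n≰n (subst (_≤ 2) |M|≡3 (maximal M M-nearlyIndependent))
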